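{- Let $n$ be an even integer. If $n>4$, the power graph of a finite cyclic group whose order has $n/2$ distinct prime factors contains a hole of length $n$. The power graph of a finite cyclic group whose order has at least two distinct prime factors each of multiplicity at least two contains a hole of length $4$.
   Context: The power graph $\mathfrak{g}(G)$ has vertex set $G$, distinct $x,y$ adjacent iff $\langle x\rangle\le\langle y\rangle$ or $\langle y\rangle\le\langle x\rangle$. A hole is a cycle such that no two of its vertices are joined by an edge not belonging to the cycle (an induced cycle). -}

module Defs where

open import Data.Nat using (ℕ; zero; suc; _*_; _^_; NonZero)
open import Data.Nat.DivMod using (_%_)
open import Data.Nat.Divisibility using (_∣_)
open import Data.Nat.Primality using (Prime)
open import Data.Fin using (Fin; toℕ)
open import Data.List using (List; length)
open import Data.List.Membership.Propositional using (_∈_)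
open import Data.List.Relation.Unary.Unique.Propositional using (Unique)
open import Data.Product using (Σ; ∃; _×_)
open import Data.Sum using (_⊎_)
open import Function.Bundles using (_⇔_)
open import Relation.Binary.PropositionalEquality using (_≡_; _≢_)
open import Relation.Nullary using (¬_)

-- The finite cyclic group of order m, modelled as ℤ/mℤ:
-- elements are Fin m, the group operation is addition modulo m.
-- The k-th multiple of y (the n-th "power" in additive notation).
_·_ : {m : ℕ} .{{_ : NonZero m}} → ℕ → Fin m → ℕ
_·_ {m} k y = (k * toℕ y) % m

_∈⟨_⟩ : {m : ℕ} .{{_ : NonZero m}} → Fin m → Fin m → Set
_∈⟨_⟩ {m} x y = ∃ λ (k : ℕ) → toℕ x ≡ (k · y)

_⟨⟩≤_ : {m : ℕ} .{{_ : NonZero m}} → Fin m → Fin m → Set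
_⟨⟩≤_ {m} x y = (z : Fin m) → z ∈⟨ x ⟩ → z ∈⟨ y ⟩

PowerAdj : {m : ℕ} .{{_ : NonZero m}} → Fin m → Fin m → Set
PowerAdj x y = x ≢ y × (x ⟨⟩≤ y ⊎ y ⟨⟩≤ x)

CycNext : {n : ℕ} → Fin n → Fin n → Set
CycNext {zero} i j = ¬ (i ≡ i)
CycNext {suc n} i j = toℕ j ≡ suc (toℕ i) % suc n

CycAdj : {n : ℕ} → Fin n → Fin n → Set
CycAdj i j = CycNext i j ⊎ CycNext j i

record Hole (m : ℕ) .{{_ : NonZero m}} (n : ℕ) : Set where
  field
    length≥3 : 3 Data.Nat.≤ n
    v        : Fin n → Fin m
    distinct : (i j : Fin n) → v i ≡ v j → i ≡ j
    edges    : (i j : Fin n) → CycAdj i j → PowerAdj (v i) (v j)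
    induced  : (i j : Fin n) → i ≢ j → ¬ CycAdj i j → ¬ PowerAdj (v i) (v j)

IsDistinctPrimeFactors : ℕ → List ℕ → Set
IsDistinctPrimeFactors m ps =
  Unique ps × ((p : ℕ) → (p ∈ ps) ⇔ (Prime p × p ∣ m))

HasNumPrimeFactors : ℕ → ℕ → Set
HasNumPrimeFactors m k = Σ (List ℕ) λ ps → IsDistinctPrimeFactors m ps × length ps ≡ k

module Submission where

-- For a divisor a > 1 of m, the element m / a of ℤ/m generates the unique subgroup of order a,
-- and two such subgroups are nested exactly when their orders divide one another. A hole in the
-- power graph is therefore a cyclic sequence of divisors of m, all > 1, in which two terms are
-- comparable under divisibility exactly when they are neighbours. For distinct primes
-- p₀, …, p₍ₖ₋₁₎ dividing m (k ≥ 3) take p₀, p₀p₁, p₁, p₁p₂, …, p₍ₖ₋₁₎, p₍ₖ₋₁₎p₀; for distinct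
-- primes p, q with p², q² ∣ m take p, p²q, q, pq².

open import Defs
open import Data.Nat using (ℕ; zero; suc; _+_; _*_; _^_; _/_; _%_; _≤_; _<_; s≤s; z≤n; _<?_; NonZero; NonTrivial;
  nonTrivial⇒nonZero; nonTrivial⇒n>1; nonTrivial⇒≢1; >-nonZero)
open import Data.Nat.Properties
open import Data.Nat.DivMod using (_mod_; m<n⇒m%n≡m; n%n≡0; m%n*o≡m*o%[n*o]; m/n<m; m/n*n≡m; m≥n⇒m/n>0)
open import Data.Nat.Divisibility
open import Data.Nat.Primality using (Prime; prime⇒irreducible; prime⇒nonZero; prime⇒nonTrivial; euclidsLemma)
open import Data.Nat.Tactic.RingSolver using (solve-∀)
open import Data.Fin using (Fin; toℕ; fromℕ<; zero; suc; combine; remQuot)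
open import Data.Fin.Properties using (toℕ-fromℕ<; toℕ<n; toℕ-injective; toℕ-combine; remQuot-combine; combine-remQuot)
open import Data.List using (List; _∷_; lookup)
open import Data.List.Membership.Propositional.Properties using (∈-lookup)
import Data.List.Relation.Unary.All as All
open import Data.List.Relation.Unary.AllPairs using (_∷_)
open import Data.List.Relation.Unary.Unique.Propositional using (Unique)
open import Data.Product using (_×_; _,_; uncurry; proj₁; proj₂)
open import Data.Sum using (_⊎_; inj₁; inj₂; [_,_]; swap)
import Data.Sum as Sum
open import Function using (_∘_)
open import Function.Bundles using (_⇔_; mk⇔; Equivalence)
open import Relation.Nullary using (¬_; yes; no; contradiction)
open import Relation.Binary.PropositionalEquality hiding ([_])
open ≡-Reasoning

next : ∀ {n} → Fin n → Fin n
next {suc n} i = suc (toℕ i) mod suc n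

toℕ-next : ∀ {n} (i : Fin (suc n)) → toℕ (next i) ≡ suc (toℕ i) % suc n
toℕ-next i = toℕ-fromℕ< _

CycNext⇒≡next : ∀ {n} {i j : Fin n} → CycNext i j → j ≡ next i
CycNext⇒≡next {suc n} {i} c = toℕ-injective (trans c (sym (toℕ-next i)))

CycNext-next : ∀ {n} (i : Fin n) → CycNext i (next i)
CycNext-next {suc n} i = toℕ-next i

CycAdj⇔≡next : ∀ {n} {s t : Fin n} → CycAdj s t ⇔ (t ≡ next s ⊎ s ≡ next t)
CycAdj⇔≡next = mk⇔ (Sum.map CycNext⇒≡next CycNext⇒≡next) (Sum.map to-next to-next)
  where
  to-next : ∀ {i j} → j ≡ next i → CycNext i j
  to-next {i} refl = CycNext-next i

toℕ-next-cases : ∀ {n} (i : Fin n) →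
  (suc (toℕ i) < n × toℕ (next i) ≡ suc (toℕ i)) ⊎ (suc (toℕ i) ≡ n × toℕ (next i) ≡ 0)
toℕ-next-cases {suc n} i with suc (toℕ i) <? suc n
... | yes i+1<n = inj₁ (i+1<n , trans (toℕ-next i) (m<n⇒m%n≡m i+1<n))
... | no i+1≮n = inj₂ (i+1≡n , trans (toℕ-next i) (trans (cong (_% suc n) i+1≡n) (n%n≡0 (suc n))))
  where i+1≡n = ≤-antisym (toℕ<n i) (≮⇒≥ i+1≮n)

next≢id : ∀ {n} → 2 ≤ n → (i : Fin n) → next i ≢ i
next≢id 2≤n i eq with toℕ-next-cases i
... | inj₁ (_ , e) = 1+n≢n (trans (sym e) (cong toℕ eq))
... | inj₂ (i+1≡n , e) = <-irrefl refl (subst (2 ≤_) n≡1 2≤n)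
  where n≡1 = trans (sym i+1≡n) (cong suc (trans (sym (cong toℕ eq)) e))

next²≢id : ∀ {n} → 3 ≤ n → (i : Fin n) → next (next i) ≢ i
next²≢id {n} 3≤n i eq with toℕ-next-cases i | toℕ-next-cases (next i)
... | inj₁ (_ , e) | inj₁ (_ , e′) = m≢1+n+m (toℕ i) (trans (sym (cong toℕ eq)) (trans e′ (cong suc e)))
... | inj₁ (_ , e) | inj₂ (j+1≡n , e′) = >⇒≢ 3≤n (begin
  n                        ≡⟨ sym j+1≡n ⟩
  suc (toℕ (next i))       ≡⟨ cong suc e ⟩
  suc (suc (toℕ i))        ≡⟨ cong (2 +_) (trans (sym (cong toℕ eq)) e′) ⟩
  2                        ∎)
... | inj₂ (i+1≡n , e) | inj₁ (_ , e′) = >⇒≢ 3≤n (begin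
  n                        ≡⟨ sym i+1≡n ⟩
  suc (toℕ i)              ≡⟨ cong suc (trans (sym (cong toℕ eq)) e′) ⟩
  suc (suc (toℕ (next i))) ≡⟨ cong (2 +_) e ⟩
  2                        ∎)
... | inj₂ (_ , e) | inj₂ (j+1≡n , _) = <⇒≢ (≤-trans (s≤s (s≤s z≤n)) 3≤n) (trans (cong suc (sym e)) j+1≡n)

-- Since toℕ (combine i b) ≡ 2 * toℕ i + toℕ b, writing the positions of a 2k-cycle as combine i b
-- turns the cyclic successor into step.
step : ∀ {k} → Fin k × Fin 2 → Fin k × Fin 2
step (i , zero) = i , suc zero
step (i , suc zero) = next i , zero

next-combine : ∀ {k} (i : Fin k) (b : Fin 2) → next (combine i b) ≡ uncurry combine (step (i , b))
next-combine {suc k} i zero = toℕ-injective (begin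
  toℕ (next (combine i zero))           ≡⟨ toℕ-next (combine i zero) ⟩
  suc (toℕ (combine i zero)) % N        ≡⟨ cong (λ x → suc x % N) (toℕ-combine i zero) ⟩
  suc (2 * toℕ i + 0) % N               ≡⟨ cong (_% N) (sym (+-suc (2 * toℕ i) 0)) ⟩
  (2 * toℕ i + 1) % N                   ≡⟨ cong (_% N) (sym (toℕ-combine i (suc zero))) ⟩
  toℕ (combine i (suc zero)) % N        ≡⟨ m<n⇒m%n≡m (toℕ<n (combine i (suc zero))) ⟩
  toℕ (combine i (suc zero))            ∎)
  where N = suc k * 2
next-combine {suc k} i (suc zero) = toℕ-injective (begin
  toℕ (next (combine i (suc zero)))     ≡⟨ toℕ-next (combine i (suc zero)) ⟩
  suc (toℕ (combine i (suc zero))) % N  ≡⟨ cong (λ x → suc x % N) (toℕ-combine i (suc zero)) ⟩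
  suc (2 * toℕ i + 1) % N               ≡⟨ cong (_% N) (double-suc (toℕ i)) ⟩
  suc (toℕ i) * 2 % N                   ≡⟨ m%n*o≡m*o%[n*o] (suc (toℕ i)) (suc k) 2 ⟨
  suc (toℕ i) % suc k * 2               ≡⟨ cong (_* 2) (toℕ-next i) ⟨
  toℕ (next i) * 2                      ≡⟨ trans (*-comm (toℕ (next i)) 2) (sym (+-identityʳ _)) ⟩
  2 * toℕ (next i) + 0                  ≡⟨ toℕ-combine (next i) zero ⟨
  toℕ (combine (next i) zero)           ∎)
  where N = suc k * 2
        double-suc : ∀ x → suc (2 * x + 1) ≡ suc x * 2
        double-suc = solve-∀

remQuot-next : ∀ {k} (s : Fin (k * 2)) → remQuot 2 (next s) ≡ step (remQuot 2 s)
remQuot-next {k} s = begin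
  remQuot 2 (next s)                         ≡⟨ cong (remQuot 2 ∘ next) (combine-remQuot {k} 2 s) ⟨
  remQuot 2 (next (combine i b))             ≡⟨ cong (remQuot 2) (next-combine i b) ⟩
  remQuot 2 (uncurry combine (step (i , b))) ≡⟨ uncurry remQuot-combine (step (i , b)) ⟩
  step (i , b)                               ∎
  where i = proj₁ (remQuot {k} 2 s)
        b = proj₂ (remQuot {k} 2 s)

prime≢1 : ∀ {p} → Prime p → p ≢ 1
prime≢1 pp = nonTrivial⇒≢1 {{prime⇒nonTrivial pp}}

prime∣prime⇒≡ : ∀ {p q} → Prime p → Prime q → p ∣ q → p ≡ q
prime∣prime⇒≡ pp pq p∣q with prime⇒irreducible pq p∣q
... | inj₁ p≡1 = contradiction p≡1 (prime≢1 pp)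
... | inj₂ p≡q = p≡q

prime∣^⇒∣ : ∀ {p n} j → Prime p → p ∣ n ^ j → p ∣ n
prime∣^⇒∣ zero pp p∣1 = contradiction (∣1⇒≡1 p∣1) (prime≢1 pp)
prime∣^⇒∣ {n = n} (suc j) pp p∣n^[1+j] with euclidsLemma n (n ^ j) pp p∣n^[1+j]
... | inj₁ p∣n = p∣n
... | inj₂ p∣n^j = prime∣^⇒∣ j pp p∣n^j

prime^-divisor : ∀ {p n o} j → Prime p → p ∤ n → p ^ j ∣ n * o → p ^ j ∣ o
prime^-divisor {o = o} zero _ _ _ = 1∣ o
prime^-divisor {p} {n} {o} (suc j) pp p∤n p^[1+j]∣no with euclidsLemma n o pp (m*n∣⇒m∣ p (p ^ j) p^[1+j]∣no)
... | inj₁ p∣n = contradiction p∣n p∤n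
... | inj₂ (divides c refl) = subst (_∣ c * p) (*-comm (p ^ j) p)
        (*-monoˡ-∣ p (prime^-divisor j pp p∤n p^j∣nc))
  where
  instance _ = prime⇒nonZero pp
  p^j∣nc : p ^ j ∣ n * c
  p^j∣nc = *-cancelʳ-∣ p (subst₂ _∣_ (*-comm p (p ^ j)) (sym (*-assoc n c p)) p^[1+j]∣no)

*-prime^-∣ : ∀ {p n m} j → Prime p → p ∤ n → n ∣ m → p ^ j ∣ m → n * p ^ j ∣ m
*-prime^-∣ {p} {n} j pp p∤n (divides c refl) p^j∣cn =
  subst (n * p ^ j ∣_) (*-comm n c) (*-monoʳ-∣ n (prime^-divisor j pp p∤n (subst (p ^ j ∣_) (*-comm c n) p^j∣cn)))

*-prime-∣ : ∀ {p n m} → Prime p → p ∤ n → n ∣ m → p ∣ m → n * p ∣ m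
*-prime-∣ {p} {n} {m} pp p∤n n∣m p∣m = subst (λ x → n * x ∣ m) (*-identityʳ p)
  (*-prime^-∣ 1 pp p∤n n∣m (subst (_∣ m) (sym (*-identityʳ p)) p∣m))

lookup-injective : ∀ {A : Set} {xs : List A} → Unique xs → ∀ {i j} → lookup xs i ≡ lookup xs j → i ≡ j
lookup-injective (_ ∷ _) {zero} {zero} _ = refl
lookup-injective (x∉xs ∷ _) {zero} {suc j} x≡xsⱼ = contradiction x≡xsⱼ (All.lookup x∉xs (∈-lookup j))
lookup-injective (x∉xs ∷ _) {suc i} {zero} xsᵢ≡x = contradiction (sym xsᵢ≡x) (All.lookup x∉xs (∈-lookup i))
lookup-injective (_ ∷ unique) {suc i} {suc j} eq = cong suc (lookup-injective unique eq)

m/n∣m/o⇔o∣n : ∀ {m n o} .{{_ : NonZero m}} .{{_ : NonZero n}} .{{_ : NonZero o}} →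
              n ∣ m → o ∣ m → (m / n ∣ m / o ⇔ o ∣ n)
m/n∣m/o⇔o∣n {m} {n} {o} n∣m o∣m = mk⇔ to from
  where
  [m/n]*n≡m = m/n*n≡m n∣m
  instance _ = >-nonZero (m≥n⇒m/n>0 (∣⇒≤ n∣m))
  to : m / n ∣ m / o → o ∣ n
  to h = *-cancelˡ-∣ (m / n) (subst (m / n * o ∣_) (sym [m/n]*n≡m) (m∣n/o⇒m*o∣n o∣m h))
  from : o ∣ n → m / n ∣ m / o
  from o∣n = m*n∣o⇒m∣o/n (m / n) o (subst (m / n * o ∣_) [m/n]*n≡m (*-monoʳ-∣ (m / n) o∣n))

module _ {m : ℕ} .{{_ : NonZero m}} where

  ∣⇒⟨⟩≤ : {x y : Fin m} → toℕ y ∣ toℕ x → x ⟨⟩≤ y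
  ∣⇒⟨⟩≤ {x} {y} (divides c x≡cy) z (k , z≡k·x) =
    k * c , trans z≡k·x (cong (_% m) (trans (cong (k *_) x≡cy) (sym (*-assoc k c (toℕ y)))))

  ⟨⟩≤⇒∣ : {x y : Fin m} → toℕ y ∣ m → x ⟨⟩≤ y → toℕ y ∣ toℕ x
  ⟨⟩≤⇒∣ {x} {y} y∣m x≤y with x≤y x (1 , sym (trans (cong (_% m) (*-identityˡ (toℕ x))) (m<n⇒m%n≡m (toℕ<n x))))
  ... | k , x≡k·y = subst (toℕ y ∣_) (sym x≡k·y) (%-presˡ-∣ (n∣m*n k) y∣m)

  elementOfOrder : (a : ℕ) .{{_ : NonTrivial a}} → Fin m
  elementOfOrder a = fromℕ< (m/n<m m a (nonTrivial⇒n>1 a))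
    where instance _ = nonTrivial⇒nonZero a

  elementOfOrder-⟨⟩≤⇔∣ : ∀ {a b} .{{_ : NonTrivial a}} .{{_ : NonTrivial b}} → a ∣ m → b ∣ m →
                          elementOfOrder a ⟨⟩≤ elementOfOrder b ⇔ a ∣ b
  elementOfOrder-⟨⟩≤⇔∣ {a} {b} a∣m b∣m = mk⇔ to from
    where
    instance _ = nonTrivial⇒nonZero a
    instance _ = nonTrivial⇒nonZero b
    toℕ-a : toℕ (elementOfOrder a) ≡ m / a
    toℕ-a = toℕ-fromℕ< _
    toℕ-b : toℕ (elementOfOrder b) ≡ m / b
    toℕ-b = toℕ-fromℕ< _
    m/b∣m/a⇔a∣b : m / b ∣ m / a ⇔ a ∣ b
    m/b∣m/a⇔a∣b = m/n∣m/o⇔o∣n b∣m a∣m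
    to : elementOfOrder a ⟨⟩≤ elementOfOrder b → a ∣ b
    to a≤b = Equivalence.to m/b∣m/a⇔a∣b
      (subst₂ _∣_ toℕ-b toℕ-a (⟨⟩≤⇒∣ (subst (_∣ m) (sym toℕ-b) (m/n∣m b∣m)) a≤b))
    from : a ∣ b → elementOfOrder a ⟨⟩≤ elementOfOrder b
    from a∣b = ∣⇒⟨⟩≤ (subst₂ _∣_ (sym toℕ-b) (sym toℕ-a) (Equivalence.from m/b∣m/a⇔a∣b a∣b))

  divisorHole : ∀ n → 3 ≤ n → (d : Fin n → ℕ) → (∀ s → NonTrivial (d s)) → (∀ s → d s ∣ m) →
                (∀ s → d s ∣ d (next s) ⊎ d (next s) ∣ d s) →
                (∀ s → d s ≢ d (next s)) →
                (∀ s t → d s ∣ d t → s ≡ t ⊎ CycAdj s t) →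
                Hole m n
  divisorHole n 3≤n d d>1 d∣m edge edge-≢ ∣⇒adjacent = record
    { length≥3 = 3≤n
    ; v        = v
    ; distinct = v-injective
    ; edges    = λ s t → edges ∘ Equivalence.to CycAdj⇔≡next
    ; induced  = induced
    }
    where
    v : Fin n → Fin m
    v s = elementOfOrder (d s) {{d>1 s}}

    v⟨⟩≤⇔∣ : ∀ {s t} → v s ⟨⟩≤ v t ⇔ d s ∣ d t
    v⟨⟩≤⇔∣ {s} {t} = elementOfOrder-⟨⟩≤⇔∣ {{d>1 s}} {{d>1 t}} (d∣m s) (d∣m t)

    d-injective : ∀ {s t} → d s ≡ d t → s ≡ t
    d-injective {s} {t} ds≡dt with ∣⇒adjacent s t (∣-reflexive ds≡dt)
    ... | inj₁ s≡t = s≡t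
    ... | inj₂ adj with Equivalence.to CycAdj⇔≡next adj
    ...   | inj₁ refl = contradiction ds≡dt (edge-≢ s)
    ...   | inj₂ refl = contradiction (sym ds≡dt) (edge-≢ t)

    v-injective : ∀ s t → v s ≡ v t → s ≡ t
    v-injective s t vs≡vt = d-injective (∣-antisym (∣-of vs≡vt) (∣-of (sym vs≡vt)))
      where
      ∣-of : ∀ {i j} → v i ≡ v j → d i ∣ d j
      ∣-of {i} vi≡vj = Equivalence.to v⟨⟩≤⇔∣ (λ z → subst (z ∈⟨_⟩) vi≡vj)

    edges : ∀ {s t} → t ≡ next s ⊎ s ≡ next t → PowerAdj (v s) (v t)
    edges {s} (inj₁ refl) =
      (λ vs≡vt → edge-≢ s (cong d (v-injective _ _ vs≡vt))) ,
      Sum.map (Equivalence.from v⟨⟩≤⇔∣) (Equivalence.from v⟨⟩≤⇔∣) (edge s)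
    edges {t = t} (inj₂ refl) =
      (λ vs≡vt → edge-≢ t (cong d (v-injective _ _ (sym vs≡vt)))) ,
      swap (Sum.map (Equivalence.from v⟨⟩≤⇔∣) (Equivalence.from v⟨⟩≤⇔∣) (edge t))

    nonadjacent-∤ : ∀ {s t} → s ≢ t → ¬ CycAdj s t → d s ∤ d t
    nonadjacent-∤ s≢t ¬adj = [ s≢t , ¬adj ] ∘ ∣⇒adjacent _ _

    induced : ∀ s t → s ≢ t → ¬ CycAdj s t → ¬ PowerAdj (v s) (v t)
    induced s t s≢t ¬adj (_ , inj₁ vs≤vt) = nonadjacent-∤ s≢t ¬adj (Equivalence.to v⟨⟩≤⇔∣ vs≤vt)
    induced s t s≢t ¬adj (_ , inj₂ vt≤vs) = nonadjacent-∤ (s≢t ∘ sym) (¬adj ∘ swap) (Equivalence.to v⟨⟩≤⇔∣ vt≤vs)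

module _ {m : ℕ} .{{_ : NonZero m}} {k : ℕ} (3≤k : 3 ≤ k) (P : Fin k → ℕ)
         (P-prime : ∀ i → Prime (P i)) (P∣m : ∀ i → P i ∣ m) (P-injective : ∀ {i j} → P i ≡ P j → i ≡ j)
         where

  P∣P⇒≡ : ∀ {i j} → P i ∣ P j → i ≡ j
  P∣P⇒≡ {i} {j} = P-injective ∘ prime∣prime⇒≡ (P-prime i) (P-prime j)

  P∣PP⇒ : ∀ {i j} → P i ∣ P j * P (next j) → i ≡ j ⊎ i ≡ next j
  P∣PP⇒ {i} {j} = Sum.map P∣P⇒≡ P∣P⇒≡ ∘ euclidsLemma (P j) (P (next j)) (P-prime i)

  next≢ : ∀ i → next i ≢ i
  next≢ = next≢id (≤-trans (n≤1+n 2) 3≤k)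

  label : Fin k × Fin 2 → ℕ
  label (i , zero)     = P i
  label (i , suc zero) = P i * P (next i)

  label>1 : ∀ x → NonTrivial (label x)
  label>1 (i , zero)     = prime⇒nonTrivial (P-prime i)
  label>1 (i , suc zero) =
    m≢0∧n>1⇒m*n>1 (P i) (P (next i)) {{prime⇒nonZero (P-prime i)}} {{prime⇒nonTrivial (P-prime (next i))}}

  label∣m : ∀ x → label x ∣ m
  label∣m (i , zero)     = P∣m i
  label∣m (i , suc zero) = *-prime-∣ (P-prime (next i)) (next≢ i ∘ P∣P⇒≡) (P∣m i) (P∣m (next i))

  label-edge : ∀ x → label x ∣ label (step x) ⊎ label (step x) ∣ label x
  label-edge (i , zero)     = inj₁ (m∣m*n (P (next i)))
  label-edge (i , suc zero) = inj₂ (n∣m*n (P i))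

  label-edge-≢ : ∀ x → label x ≢ label (step x)
  label-edge-≢ (i , zero)     Pi≡PiPi′ = next≢ i (P∣P⇒≡ (∣-trans (n∣m*n (P i)) (∣-reflexive (sym Pi≡PiPi′))))
  label-edge-≢ (i , suc zero) PiPi′≡Pi′ = next≢ i (sym (P∣P⇒≡ (∣-trans (m∣m*n (P (next i))) (∣-reflexive PiPi′≡Pi′))))

  label-∣ : ∀ x y → label x ∣ label y → x ≡ y ⊎ y ≡ step x ⊎ x ≡ step y
  label-∣ (i , zero) (j , zero) h with refl ← P∣P⇒≡ h = inj₁ refl
  label-∣ (i , zero) (j , suc zero) h with P∣PP⇒ h
  ... | inj₁ refl = inj₂ (inj₁ refl)
  ... | inj₂ refl = inj₂ (inj₂ refl)
  label-∣ (i , suc zero) (j , zero) h with refl ← P∣P⇒≡ (m*n∣⇒m∣ (P i) _ h) =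
    contradiction (P∣P⇒≡ (m*n∣⇒n∣ (P i) _ h)) (next≢ i)
  label-∣ (i , suc zero) (j , suc zero) h with P∣PP⇒ (m*n∣⇒m∣ (P i) _ h) | P∣PP⇒ (m*n∣⇒n∣ (P i) _ h)
  ... | inj₁ refl | _         = inj₁ refl
  ... | inj₂ refl | inj₁ eq   = contradiction eq (next²≢id 3≤k j)
  ... | inj₂ refl | inj₂ eq   = contradiction eq (next≢ (next j))

  split : Fin (k * 2) → Fin k × Fin 2
  split = remQuot 2

  split-injective : ∀ {s t} → split s ≡ split t → s ≡ t
  split-injective {s} {t} eq = begin
    s                         ≡⟨ combine-remQuot {k} 2 s ⟨
    uncurry combine (split s) ≡⟨ cong (uncurry combine) eq ⟩
    uncurry combine (split t) ≡⟨ combine-remQuot {k} 2 t ⟩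
    t                         ∎

  distinctPrimesHole : Hole m (2 * k)
  distinctPrimesHole = subst (Hole m) (*-comm k 2)
    (divisorHole (k * 2) (≤-trans 3≤k (m≤m*n k 2)) d (label>1 ∘ split) (label∣m ∘ split) edge edge-≢ ∣⇒adjacent)
    where
    d : Fin (k * 2) → ℕ
    d = label ∘ split
    d-next : ∀ s → d (next s) ≡ label (step (split s))
    d-next s = cong label (remQuot-next s)
    edge : ∀ s → d s ∣ d (next s) ⊎ d (next s) ∣ d s
    edge s = subst (λ y → d s ∣ y ⊎ y ∣ d s) (sym (d-next s)) (label-edge (split s))
    edge-≢ : ∀ s → d s ≢ d (next s)
    edge-≢ s = subst (d s ≢_) (sym (d-next s)) (label-edge-≢ (split s))
    ∣⇒adjacent : ∀ s t → d s ∣ d t → s ≡ t ⊎ CycAdj s t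
    ∣⇒adjacent s t h = Sum.map split-injective (Equivalence.from CycAdj⇔≡next ∘ Sum.map (≡next s) (≡next t))
                                (label-∣ (split s) (split t) h)
      where
      ≡next : ∀ i {j} → split j ≡ step (split i) → j ≡ next i
      ≡next i eq = split-injective (trans eq (sym (remQuot-next i)))

squaresHole : (m p q : ℕ) .{{_ : NonZero m}} → Prime p → Prime q → p ≢ q → p ^ 2 ∣ m → q ^ 2 ∣ m → Hole m 4
squaresHole m p q pp pq p≢q p²∣m q²∣m =
  divisorHole 4 (s≤s (s≤s (s≤s z≤n))) d d>1 d∣m edge edge-≢ ∣⇒adjacent
  where
  instance _ = prime⇒nonZero pp
  instance _ = prime⇒nonZero pq
  instance _ = prime⇒nonTrivial pp
  instance _ = prime⇒nonTrivial pq
  p∤q : p ∤ q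
  p∤q = p≢q ∘ prime∣prime⇒≡ pp pq
  q∤p : q ∤ p
  q∤p = p≢q ∘ sym ∘ prime∣prime⇒≡ pq pp
  r = p * q
  instance
    r>1 : NonTrivial r
    r>1 = m≢0∧n>1⇒m*n>1 p q
    r≢0 : NonZero r
    r≢0 = nonTrivial⇒nonZero r
  d : Fin 4 → ℕ
  d zero                   = p
  d (suc zero)             = p * r
  d (suc (suc zero))       = q
  d (suc (suc (suc zero))) = q * r
  d>1 : ∀ s → NonTrivial (d s)
  d>1 zero                   = prime⇒nonTrivial pp
  d>1 (suc zero)             = m≢0∧n>1⇒m*n>1 p r
  d>1 (suc (suc zero))       = prime⇒nonTrivial pq
  d>1 (suc (suc (suc zero))) = m≢0∧n>1⇒m*n>1 q r
  r*r∣m : r * r ∣ m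
  r*r∣m = subst (_∣ m) (p²q²≡r*r p q) (*-prime^-∣ 2 pq (q∤p ∘ prime∣^⇒∣ 2 pq) p²∣m q²∣m)
    where
    p²q²≡r*r : ∀ p q → p * (p * 1) * (q * (q * 1)) ≡ p * q * (p * q)
    p²q²≡r*r = solve-∀
  p∣r : p ∣ r
  p∣r = m∣m*n q
  q∣r : q ∣ r
  q∣r = n∣m*n p
  d∣m : ∀ s → d s ∣ m
  d∣m zero                   = ∣-trans (∣-trans p∣r (m∣m*n r)) r*r∣m
  d∣m (suc zero)             = ∣-trans (*-monoˡ-∣ r p∣r) r*r∣m
  d∣m (suc (suc zero))       = ∣-trans (∣-trans q∣r (m∣m*n r)) r*r∣m
  d∣m (suc (suc (suc zero))) = ∣-trans (*-monoˡ-∣ r q∣r) r*r∣m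
  edge : ∀ s → d s ∣ d (next s) ⊎ d (next s) ∣ d s
  edge zero                   = inj₁ (m∣m*n r)
  edge (suc zero)             = inj₂ (∣n⇒∣m*n p q∣r)
  edge (suc (suc zero))       = inj₁ (m∣m*n r)
  edge (suc (suc (suc zero))) = inj₂ (∣n⇒∣m*n q p∣r)
  edge-≢ : ∀ s → d s ≢ d (next s)
  edge-≢ zero                   p≡pr = q∤p (∣-trans (∣n⇒∣m*n p q∣r) (∣-reflexive (sym p≡pr)))
  edge-≢ (suc zero)             pr≡q = p∤q (∣-trans (m∣m*n r) (∣-reflexive pr≡q))
  edge-≢ (suc (suc zero))       q≡qr = p∤q (∣-trans (∣n⇒∣m*n q p∣r) (∣-reflexive (sym q≡qr)))
  edge-≢ (suc (suc (suc zero))) qr≡p = q∤p (∣-trans (m∣m*n r) (∣-reflexive qr≡p))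
  pr∤qr : p * r ∤ q * r
  pr∤qr = p∤q ∘ *-cancelʳ-∣ r
  qr∤pr : q * r ∤ p * r
  qr∤pr = q∤p ∘ *-cancelʳ-∣ r
  ∣⇒adjacent : ∀ s t → d s ∣ d t → s ≡ t ⊎ CycAdj s t
  ∣⇒adjacent zero                   zero                   _ = inj₁ refl
  ∣⇒adjacent zero                   (suc zero)             _ = inj₂ (inj₁ refl)
  ∣⇒adjacent zero                   (suc (suc zero))       h = contradiction h p∤q
  ∣⇒adjacent zero                   (suc (suc (suc zero))) _ = inj₂ (inj₂ refl)
  ∣⇒adjacent (suc zero)             zero                   _ = inj₂ (inj₂ refl)
  ∣⇒adjacent (suc zero)             (suc zero)             _ = inj₁ refl
  ∣⇒adjacent (suc zero)             (suc (suc zero))       _ = inj₂ (inj₁ refl)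
  ∣⇒adjacent (suc zero)             (suc (suc (suc zero))) h = contradiction h pr∤qr
  ∣⇒adjacent (suc (suc zero))       zero                   h = contradiction h q∤p
  ∣⇒adjacent (suc (suc zero))       (suc zero)             _ = inj₂ (inj₂ refl)
  ∣⇒adjacent (suc (suc zero))       (suc (suc zero))       _ = inj₁ refl
  ∣⇒adjacent (suc (suc zero))       (suc (suc (suc zero))) _ = inj₂ (inj₁ refl)
  ∣⇒adjacent (suc (suc (suc zero))) zero                   _ = inj₂ (inj₁ refl)
  ∣⇒adjacent (suc (suc (suc zero))) (suc zero)             h = contradiction h qr∤pr
  ∣⇒adjacent (suc (suc (suc zero))) (suc (suc zero))       _ = inj₂ (inj₂ refl)
  ∣⇒adjacent (suc (suc (suc zero))) (suc (suc (suc zero))) _ = inj₁ refl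

proposition19 :
    ((k m : ℕ) .{{_ : NonZero m}} → 3 ≤ k → HasNumPrimeFactors m k → Hole m (2 * k))
    × ((m p q : ℕ) .{{_ : NonZero m}} → Prime p → Prime q → p ≢ q
        → p ^ 2 ∣ m → q ^ 2 ∣ m → Hole m 4)
proposition19 = distinctPrimeFactorsHole , squaresHole
  where
  distinctPrimeFactorsHole : (k m : ℕ) .{{_ : NonZero m}} → 3 ≤ k → HasNumPrimeFactors m k → Hole m (2 * k)
  distinctPrimeFactorsHole _ m 3≤k (ps , (unique , ∈ps⇔) , refl) =
    distinctPrimesHole 3≤k (lookup ps) (proj₁ ∘ prime∧∣m) (proj₂ ∘ prime∧∣m) (lookup-injective unique)
    where
    prime∧∣m : ∀ i → Prime (lookup ps i) × lookup ps i ∣ m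
    prime∧∣m i = Equivalence.to (∈ps⇔ (lookup ps i)) (∈-lookup i)
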